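{- Let $X=(x_1,\dots,x_n)$, let $\mathcal{S}\subseteq\mathbb{Q}[X]$ and let $m$ be a positive integer. Set $\mathcal{S}^m=\{P(x_1^m,\dots,x_n^m) : P\in\mathcal{S}\}$, and for an ideal $I$ let $G(I)$ denote its reduced monic Gröbner basis with respect to the lexicographic order. Then $$G(\langle\mathcal{S}^m\rangle)=G(\langle\mathcal{S}\rangle)^m,$$ where $\langle\cdot\rangle$ denotes the generated ideal in $\mathbb{Q}[X]$ and $G(\langle\mathcal{S}\rangle)^m=\{g(x_1^m,\dots,x_n^m): g\in G(\langle\mathcal{S}\rangle)\}$.
   Context: The lexicographic order on monomials: $x^\nu>x^\mu$ iff the first nonzero entry of $\nu-\mu$ is positive, where $x^\nu=x_1^{\nu_1}\cdots x_n^{\nu_n}$. -}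

module Defs where

open import Data.Nat as ℕ using (ℕ; zero; suc; _<_)
open import Data.Rational as ℚ using (ℚ; 0ℚ; 1ℚ)
open import Data.Vec using (Vec; []; _∷_; zipWith; replicate)
import Data.Vec as Vec
open import Data.Vec.Properties using (≡-dec)
open import Data.Vec.Relation.Binary.Pointwise.Inductive using (Pointwise)
open import Data.List using (List; []; _∷_; map; concatMap; foldr; length; lookup)
open import Data.List.Relation.Unary.All using (All)
open import Data.List.Membership.Propositional using (_∈_)
open import Data.Product using (Σ; ∃; _×_; _,_; proj₁; proj₂)
open import Data.Fin using (Fin)
open import Relation.Binary.PropositionalEquality using (_≡_; _≢_)
open import Relation.Nullary using (yes; no; ¬_)

Mon : ℕ → Set
Mon n = Vec ℕ n

data _>lex_ : {n : ℕ} → Mon n → Mon n → Set where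
  here : ∀ {n a b} {ν μ : Mon n} → b < a → (a ∷ ν) >lex (b ∷ μ)
  there : ∀ {n a} {ν μ : Mon n} → ν >lex μ → (a ∷ ν) >lex (a ∷ μ)

_∣ᵐ_ : {n : ℕ} → Mon n → Mon n → Set
μ ∣ᵐ ν = Pointwise ℕ._≤_ μ ν

-- Polynomials in ℚ[x₁,…,xₙ] represented as finite lists of terms c·x^ν.
-- Representations are compared via their coefficient function (see _≈ₚ_).
Poly : ℕ → Set
Poly n = List (ℚ × Mon n)

coeff : {n : ℕ} → Poly n → Mon n → ℚ
coeff [] μ = 0ℚ
coeff ((c , ν) ∷ p) μ with ≡-dec ℕ._≟_ ν μ
... | yes _ = c ℚ.+ coeff p μ
... | no  _ = coeff p μ

_≈ₚ_ : {n : ℕ} → Poly n → Poly n → Set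
p ≈ₚ q = ∀ μ → coeff p μ ≡ coeff q μ

_+ₚ_ : {n : ℕ} → Poly n → Poly n → Poly n
p +ₚ q = p Data.List.++ q

_*ₚ_ : {n : ℕ} → Poly n → Poly n → Poly n
p *ₚ q = concatMap (λ t → map (λ s → (proj₁ t ℚ.* proj₁ s , zipWith ℕ._+_ (proj₂ t) (proj₂ s))) q) p

0ₚ : {n : ℕ} → Poly n
0ₚ = []

sumₚ : {n : ℕ} → List (Poly n) → Poly n
sumₚ = foldr _+ₚ_ 0ₚ

powSubst : {n : ℕ} → ℕ → Poly n → Poly n
powSubst m = map (λ t → (proj₁ t , Vec.map (ℕ._* m) (proj₂ t)))

PolySet : ℕ → Set₁
PolySet n = Poly n → Set

_^ˢ_ : {n : ℕ} → PolySet n → ℕ → PolySet n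
(S ^ˢ m) Q = Σ _ λ P → S P × (Q ≈ₚ powSubst m P)

⟨_⟩ : {n : ℕ} → PolySet n → PolySet n
⟨ S ⟩ f = Σ (List (Poly _ × Poly _)) λ cs →
  All (λ hs → S (proj₂ hs)) cs × (f ≈ₚ sumₚ (map (λ hs → proj₁ hs *ₚ proj₂ hs) cs))

IsLM : {n : ℕ} → Poly n → Mon n → Set
IsLM p μ = (coeff p μ ≢ 0ℚ) × (∀ ν → coeff p ν ≢ 0ℚ → ν ≢ μ → μ >lex ν)

record IsReducedGB {n : ℕ} (I : PolySet n) (G : List (Poly n)) : Set where
  field
    inIdeal : All I G
    monic   : All (λ g → Σ (Mon n) λ μ → IsLM g μ × coeff g μ ≡ 1ℚ) G
    groebner : ∀ f μ → I f → IsLM f μ →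
               Σ (Poly n) λ g → g ∈ G × Σ (Mon n) λ ν → IsLM g ν × ν ∣ᵐ μ
    reduced : ∀ (i j : Fin (length G)) → i ≢ j → ∀ μ ν →
              coeff (lookup G i) μ ≢ 0ℚ → IsLM (lookup G j) ν → ¬ (ν ∣ᵐ μ)

_≈ˢ_ : {n : ℕ} → List (Poly n) → List (Poly n) → Set
G ≈ˢ H = (All (λ g → Σ _ λ h → h ∈ H × g ≈ₚ h) G) × (All (λ h → Σ _ λ g → g ∈ G × h ≈ₚ g) H)

-- (1) Uniqueness: any two reduced monic Gröbner bases G, H of the same
--     ideal I coincide (up to ≈ₚ).  Each h ∈ H has a partner g ∈ G with
--     the same leading monomial; h − g ∈ I, and reducedness forces every
--     monomial of h − g that is divisible by a leading monomial of G to be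
--     that common leading monomial, where h − g vanishes; so h − g = 0.
--
-- (2) Gᵐ is a reduced monic Gröbner basis of ⟨Sᵐ⟩.  The substitution is
--     a ring homomorphism that multiplies exponents by m, so it preserves
--     ideal membership, leading monomials, monicity and reducedness.  For
--     the Gröbner property, split a monomial μ as r + m·q with 0 ≤ rᵢ < m.
--     The "residue slice" f ↦ f⁽ʳ⁾, keeping the monomials r + m·x of f
--     as x, maps ⟨Sᵐ⟩ into ⟨S⟩ (since (h·Pᵐ)⁽ʳ⁾ = h⁽ʳ⁾·P) and sends a
--     leading monomial μ of f to the leading monomial q of f⁽ʳ⁾.  A basis
--     element g ∈ G with LM g ∣ q then gives LM gᵐ = m·LM g ∣ μ.
--
-- The theorem follows by applying (1) to Gᵐ and H.
module Submission where

open import Defs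
open import Data.Nat using (ℕ; _≤_; s≤s; z≤n)
open import Data.List using (List; map)

import Data.Nat as N
import Data.Nat.Properties as NP
open import Data.Nat.DivMod using (_%_; _/_; m≡m%n+[m/n]*n; [m+kn]%n≡m%n; m<n⇒m%n≡m; m%n<n)
open import Data.Rational as Q using (ℚ; 0ℚ; 1ℚ)
import Data.Rational.Properties as QP
open import Algebra.Properties.Group QP.+-0-group using (x∙y⁻¹≈ε⇒x≈y)
open import Data.Vec as V using ([]; _∷_; zipWith)
open import Data.Vec.Properties using (≡-dec)
import Data.Vec.Relation.Binary.Pointwise.Inductive as PW
import Data.Vec.Relation.Unary.All as VA
open import Data.List using ([]; _∷_; _++_; length; lookup)
import Data.List.Properties as LP
open import Data.List.Relation.Unary.All as LA using (All; []; _∷_)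
import Data.List.Relation.Unary.All.Properties as LAP
open import Data.List.Relation.Unary.Any as Any using (here; there)
import Data.List.Relation.Unary.Any.Properties as AnyP
open import Data.List.Membership.Propositional using (_∈_)
open import Data.List.Membership.Propositional.Properties using (∈-map⁺; ∈-lookup)
open import Data.Product using (Σ; _×_; _,_; proj₁; proj₂)
open import Data.Sum using (_⊎_; inj₁; inj₂)
open import Data.Empty using (⊥; ⊥-elim)
open import Data.Fin as F using (Fin; zero; suc)
import Data.Fin.Properties as FP
open import Relation.Binary.PropositionalEquality
open import Relation.Nullary using (¬_; yes; no)
open import Function using (_∘_)
open import Relation.Binary using (tri<; tri≈; tri>)

coeff-++ : ∀ {n} (p q : Poly n) μ → coeff (p ++ q) μ ≡ coeff p μ Q.+ coeff q μ
coeff-++ [] q μ = sym (QP.+-identityˡ _)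
coeff-++ ((c , ν) ∷ p) q μ with ≡-dec N._≟_ ν μ
... | yes _ = trans (cong (c Q.+_) (coeff-++ p q μ)) (sym (QP.+-assoc c _ _))
... | no _ = coeff-++ p q μ

-ₚ_ : ∀ {n} → Poly n → Poly n
-ₚ_ = map (λ t → (Q.- proj₁ t , proj₂ t))

_-ₚ_ : ∀ {n} → Poly n → Poly n → Poly n
p -ₚ q = p ++ (-ₚ q)

coeff-neg : ∀ {n} (p : Poly n) μ → coeff (-ₚ p) μ ≡ Q.- coeff p μ
coeff-neg [] μ = refl
coeff-neg ((c , ν) ∷ p) μ with ≡-dec N._≟_ ν μ
... | yes _ = trans (cong (Q.- c Q.+_) (coeff-neg p μ)) (sym (QP.neg-distrib-+ c _))
... | no _ = coeff-neg p μ

coeff-− : ∀ {n} (p q : Poly n) μ → coeff (p -ₚ q) μ ≡ coeff p μ Q.- coeff q μ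
coeff-− p q μ = trans (coeff-++ p (-ₚ q) μ) (cong (coeff p μ Q.+_) (coeff-neg q μ))

coeff-−≡0 : ∀ {n} (p q : Poly n) μ → coeff (p -ₚ q) μ ≡ 0ℚ → coeff p μ ≡ coeff q μ
coeff-−≡0 p q μ z = x∙y⁻¹≈ε⇒x≈y _ _ (trans (sym (coeff-− p q μ)) z)

-- Termwise maps c·x^ν ↦ κ(c)·x^φ(ν), for κ additive and φ injective.  Both
-- the substitution x ↦ xᵐ and multiplication by a single term are of this
-- form; such maps act on coefficients by κ and so respect ≈ₚ.

mapT : ∀ {n} → (ℚ → ℚ) → (Mon n → Mon n) → Poly n → Poly n
mapT κ φ = map (λ t → (κ (proj₁ t) , φ (proj₂ t)))

module TermMap {n : ℕ} (κ : ℚ → ℚ) (φ : Mon n → Mon n)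
  (κ-0 : κ 0ℚ ≡ 0ℚ) (κ-+ : ∀ a b → κ (a Q.+ b) ≡ κ a Q.+ κ b)
  (φ-inj : ∀ {x y} → φ x ≡ φ y → x ≡ y) where

  coeff-image : ∀ (p : Poly n) ν → coeff (mapT κ φ p) (φ ν) ≡ κ (coeff p ν)
  coeff-image [] ν = sym κ-0
  coeff-image ((c , σ) ∷ p) ν with ≡-dec N._≟_ (φ σ) (φ ν) | ≡-dec N._≟_ σ ν
  ... | yes _ | yes _ = trans (cong (κ c Q.+_) (coeff-image p ν)) (sym (κ-+ c _))
  ... | yes e | no ne = ⊥-elim (ne (φ-inj e))
  ... | no ne | yes e = ⊥-elim (ne (cong φ e))
  ... | no _ | no _ = coeff-image p ν

  support-image : ∀ (p : Poly n) μ → coeff (mapT κ φ p) μ ≢ 0ℚ → Σ (Mon n) λ ν → μ ≡ φ ν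
  support-image [] μ nz = ⊥-elim (nz refl)
  support-image ((c , σ) ∷ p) μ nz with ≡-dec N._≟_ (φ σ) μ
  ... | yes e = σ , sym e
  ... | no _ = support-image p μ nz

  resp-≈ : ∀ (p q : Poly n) → p ≈ₚ q → mapT κ φ p ≈ₚ mapT κ φ q
  resp-≈ p q p≈q μ with coeff (mapT κ φ p) μ Q.≟ 0ℚ | coeff (mapT κ φ q) μ Q.≟ 0ℚ
  ... | yes zp | yes zq = trans zp (sym zq)
  ... | no nzp | _ with support-image p μ nzp
  ...   | ν , refl = trans (coeff-image p ν) (trans (cong κ (p≈q ν)) (sym (coeff-image q ν)))
  resp-≈ p q p≈q μ | yes _ | no nzq with support-image q μ nzq
  ...   | ν , refl = trans (coeff-image p ν) (trans (cong κ (p≈q ν)) (sym (coeff-image q ν)))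

-- Multiplication by the single term c·x^ν; p *ₚ q unfolds into these blocks.
termMul : ∀ {n} → ℚ → Mon n → Poly n → Poly n
termMul c ν = mapT (c Q.*_) (zipWith N._+_ ν)

zipWith-+-cancelˡ : ∀ {n} (ν : Mon n) {x y : Mon n} → zipWith N._+_ ν x ≡ zipWith N._+_ ν y → x ≡ y
zipWith-+-cancelˡ [] {[]} {[]} e = refl
zipWith-+-cancelˡ (c ∷ ν) {a ∷ x} {b ∷ y} e =
  cong₂ _∷_ (NP.+-cancelˡ-≡ c a b (cong V.head e)) (zipWith-+-cancelˡ ν (cong V.tail e))

module TermMul {n : ℕ} (c : ℚ) (ν : Mon n) =
  TermMap (c Q.*_) (zipWith N._+_ ν) (QP.*-zeroʳ c) (QP.*-distribˡ-+ c) (zipWith-+-cancelˡ ν)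

*ₚ-respʳ-≈ : ∀ {n} (p q q' : Poly n) → q ≈ₚ q' → (p *ₚ q) ≈ₚ (p *ₚ q')
*ₚ-respʳ-≈ [] q q' e μ = refl
*ₚ-respʳ-≈ ((c , ν) ∷ p) q q' e μ =
  trans (coeff-++ (termMul c ν q) (p *ₚ q) μ)
  (trans (cong₂ Q._+_ (TermMul.resp-≈ c ν q q' e μ) (*ₚ-respʳ-≈ p q q' e μ))
         (sym (coeff-++ (termMul c ν q') (p *ₚ q') μ)))

>lex-irrefl : ∀ {n} {x y : Mon n} → x >lex y → x ≢ y
>lex-irrefl (here b<a) refl = NP.<-irrefl refl b<a
>lex-irrefl (there p) refl = >lex-irrefl p refl

>lex-trans : ∀ {n} {x y z : Mon n} → x >lex y → y >lex z → x >lex z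
>lex-trans (here p) (here q) = here (NP.<-trans q p)
>lex-trans (here p) (there q) = here p
>lex-trans (there p) (here q) = here q
>lex-trans (there p) (there q) = there (>lex-trans p q)

>lex-trichotomy : ∀ {n} (x y : Mon n) → x ≡ y ⊎ (x >lex y ⊎ y >lex x)
>lex-trichotomy [] [] = inj₁ refl
>lex-trichotomy (a ∷ x) (b ∷ y) with NP.<-cmp a b
... | tri< a<b _ _ = inj₂ (inj₂ (here a<b))
... | tri> _ _ b<a = inj₂ (inj₁ (here b<a))
... | tri≈ _ refl _ with >lex-trichotomy x y
...   | inj₁ refl = inj₁ refl
...   | inj₂ (inj₁ p) = inj₂ (inj₁ (there p))
...   | inj₂ (inj₂ p) = inj₂ (inj₂ (there p))

∣ᵐ⇒¬>lex : ∀ {n} {x y : Mon n} → x ∣ᵐ y → ¬ (x >lex y)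
∣ᵐ⇒¬>lex (a≤b PW.∷ _) (here b<a) = NP.<⇒≱ b<a a≤b
∣ᵐ⇒¬>lex (_ PW.∷ r) (there p) = ∣ᵐ⇒¬>lex r p

∣ᵐ-trans : ∀ {n} {x y z : Mon n} → x ∣ᵐ y → y ∣ᵐ z → x ∣ᵐ z
∣ᵐ-trans = PW.trans NP.≤-trans

∣ᵐ-antisym : ∀ {n} {x y : Mon n} → x ∣ᵐ y → y ∣ᵐ x → x ≡ y
∣ᵐ-antisym PW.[] PW.[] = refl
∣ᵐ-antisym (p PW.∷ ps) (q PW.∷ qs) = cong₂ _∷_ (NP.≤-antisym p q) (∣ᵐ-antisym ps qs)

LM-unique : ∀ {n} (p : Poly n) {μ ν} → IsLM p μ → IsLM p ν → μ ≡ ν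
LM-unique p {μ} {ν} (nzμ , maxμ) (nzν , maxν) with ≡-dec N._≟_ μ ν
... | yes e = e
... | no ne = ⊥-elim (>lex-irrefl (>lex-trans (maxμ ν nzν (ne ∘ sym)) (maxν μ nzμ ne)) refl)

LM-divides⇒≡ : ∀ {n} (p : Poly n) {μ δ} → IsLM p μ → coeff p δ ≢ 0ℚ → μ ∣ᵐ δ → δ ≡ μ
LM-divides⇒≡ p {μ} {δ} (_ , maxμ) nzδ μ∣δ with ≡-dec N._≟_ δ μ
... | yes e = e
... | no ne = ⊥-elim (∣ᵐ⇒¬>lex μ∣δ (maxμ δ nzδ ne))

support⊆terms : ∀ {n} (p : Poly n) μ → coeff p μ ≢ 0ℚ → μ ∈ map proj₂ p
support⊆terms [] μ nz = ⊥-elim (nz refl)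
support⊆terms ((c , ν) ∷ p) μ nz with ≡-dec N._≟_ ν μ
... | yes e = here (sym e)
... | no _ = there (support⊆terms p μ nz)

data LexMax {n} (p : Poly n) (νs : List (Mon n)) : Set where
  none : All (λ ν → coeff p ν ≡ 0ℚ) νs → LexMax p νs
  some : ∀ μ → coeff p μ ≢ 0ℚ → (∀ ν → ν ∈ νs → coeff p ν ≢ 0ℚ → ν ≢ μ → μ >lex ν) → LexMax p νs

lexMax : ∀ {n} (p : Poly n) νs → LexMax p νs
lexMax p [] = none []
lexMax p (x ∷ νs) with lexMax p νs | coeff p x Q.≟ 0ℚ
... | none zs | yes zx = none (zx ∷ zs)
... | none zs | no nzx = some x nzx λ { ν (here refl) nzν ne → ⊥-elim (ne refl)
                                   ; ν (there ν∈) nzν ne → ⊥-elim (nzν (LA.lookup zs ν∈)) }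
... | some μ nzμ max | yes zx = some μ nzμ λ { ν (here refl) nzν ne → ⊥-elim (nzν zx)
                                            ; ν (there ν∈) nzν ne → max ν ν∈ nzν ne }
... | some μ nzμ max | no nzx with >lex-trichotomy x μ
...   | inj₁ refl = some μ nzμ λ { ν (here refl) nzν ne → ⊥-elim (ne refl)
                                ; ν (there ν∈) nzν ne → max ν ν∈ nzν ne }
...   | inj₂ (inj₂ μ>x) = some μ nzμ λ { ν (here refl) nzν ne → μ>x
                                      ; ν (there ν∈) nzν ne → max ν ν∈ nzν ne }
...   | inj₂ (inj₁ x>μ) = some x nzx λ { ν (here refl) nzν ne → ⊥-elim (ne refl)
                                      ; ν (there ν∈) nzν ne → below ν ν∈ nzν ne }
  where
  below : ∀ ν → ν ∈ νs → coeff p ν ≢ 0ℚ → ν ≢ x → x >lex ν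
  below ν ν∈ nzν ne with ≡-dec N._≟_ ν μ
  ... | yes refl = x>μ
  ... | no ne' = >lex-trans x>μ (max ν ν∈ nzν ne')

LM-exists : ∀ {n} (p : Poly n) μ → coeff p μ ≢ 0ℚ → Σ (Mon n) (IsLM p)
LM-exists p μ nz with lexMax p (map proj₂ p)
... | none zs = ⊥-elim (nz (LA.lookup zs (support⊆terms p μ nz)))
... | some δ nzδ max = δ , nzδ , λ ν nzν ne → max ν (support⊆terms p ν nzν) nzν ne

term : ∀ {n} → Poly n × Poly n → Poly n
term hs = proj₁ hs *ₚ proj₂ hs

negCofactor : ∀ {n} → Poly n × Poly n → Poly n × Poly n
negCofactor hs = (-ₚ proj₁ hs , proj₂ hs)

-ₚ-termMul : ∀ {n} c (ν : Mon n) (s : Poly n) → -ₚ termMul c ν s ≡ termMul (Q.- c) ν s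
-ₚ-termMul c ν [] = refl
-ₚ-termMul c ν ((d , σ) ∷ s) = cong₂ _∷_ (cong (_, _) (QP.neg-distribˡ-* c d)) (-ₚ-termMul c ν s)

-ₚ-*ₚ : ∀ {n} (h s : Poly n) → (-ₚ h) *ₚ s ≡ -ₚ (h *ₚ s)
-ₚ-*ₚ [] s = refl
-ₚ-*ₚ ((c , ν) ∷ h) s =
  trans (cong₂ _++_ (sym (-ₚ-termMul c ν s)) (-ₚ-*ₚ h s))
        (sym (LP.map-++ _ (termMul c ν s) (h *ₚ s)))

coeff-sum-++ : ∀ {n} (xs ys : List (Poly n × Poly n)) μ →
  coeff (sumₚ (map term (xs ++ ys))) μ ≡ coeff (sumₚ (map term xs)) μ Q.+ coeff (sumₚ (map term ys)) μ
coeff-sum-++ [] ys μ = sym (QP.+-identityˡ _)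
coeff-sum-++ (x ∷ xs) ys μ =
  trans (coeff-++ (term x) _ μ)
  (trans (cong (coeff (term x) μ Q.+_) (coeff-sum-++ xs ys μ))
  (trans (sym (QP.+-assoc (coeff (term x) μ) _ _))
         (cong (Q._+ _) (sym (coeff-++ (term x) _ μ)))))

coeff-sum-neg : ∀ {n} (cs : List (Poly n × Poly n)) μ →
  coeff (sumₚ (map term (map negCofactor cs))) μ ≡ Q.- coeff (sumₚ (map term cs)) μ
coeff-sum-neg [] μ = refl
coeff-sum-neg ((h , s) ∷ cs) μ = begin
  coeff ((-ₚ h) *ₚ s ++ rest') μ               ≡⟨ coeff-++ ((-ₚ h) *ₚ s) rest' μ ⟩
  coeff ((-ₚ h) *ₚ s) μ Q.+ coeff rest' μ       ≡⟨ cong₂ Q._+_ neg-head (coeff-sum-neg cs μ) ⟩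
  Q.- coeff (h *ₚ s) μ Q.+ Q.- coeff rest μ     ≡⟨ sym (QP.neg-distrib-+ (coeff (h *ₚ s) μ) _) ⟩
  Q.- (coeff (h *ₚ s) μ Q.+ coeff rest μ)       ≡⟨ cong Q.-_ (sym (coeff-++ (h *ₚ s) rest μ)) ⟩
  Q.- coeff (h *ₚ s ++ rest) μ                  ∎
  where
  open ≡-Reasoning
  rest = sumₚ (map term cs)
  rest' = sumₚ (map term (map negCofactor cs))
  neg-head : coeff ((-ₚ h) *ₚ s) μ ≡ Q.- coeff (h *ₚ s) μ
  neg-head = trans (cong (λ z → coeff z μ) (-ₚ-*ₚ h s)) (coeff-neg (h *ₚ s) μ)

⟨⟩-closed-− : ∀ {n} (T : PolySet n) f g → ⟨ T ⟩ f → ⟨ T ⟩ g → ⟨ T ⟩ (f -ₚ g)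
⟨⟩-closed-− T f g (cs , Tcs , f≈) (ds , Tds , g≈) =
  cs ++ map negCofactor ds , LAP.++⁺ Tcs (LAP.map⁺ Tds) , λ μ → begin
    coeff (f -ₚ g) μ                                   ≡⟨ coeff-− f g μ ⟩
    coeff f μ Q.- coeff g μ                             ≡⟨ cong₂ Q._-_ (f≈ μ) (g≈ μ) ⟩
    coeff (sumₚ (map term cs)) μ Q.- coeff (sumₚ (map term ds)) μ
      ≡⟨ cong (coeff (sumₚ (map term cs)) μ Q.+_) (sym (coeff-sum-neg ds μ)) ⟩
    coeff (sumₚ (map term cs)) μ Q.+ coeff (sumₚ (map term (map negCofactor ds))) μ
      ≡⟨ sym (coeff-sum-++ cs (map negCofactor ds) μ) ⟩
    coeff (sumₚ (map term (cs ++ map negCofactor ds))) μ ∎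
  where open ≡-Reasoning

module Uniqueness {n : ℕ} (I : PolySet n)
  (closed-− : ∀ f g → I f → I g → I (f -ₚ g)) where

  reduced-∈ : ∀ {G} → IsReducedGB I G → ∀ {h h' μ ν} → h ∈ G → h' ∈ G →
              coeff h μ ≢ 0ℚ → IsLM h' ν → ν ∣ᵐ μ → h ≡ h'
  reduced-∈ {G} R {h} {h'} {μ} {ν} h∈ h'∈ nz lm ν∣μ with Any.index h∈ F.≟ Any.index h'∈
  ... | yes e = trans (AnyP.lookup-index h∈) (trans (cong (lookup G) e) (sym (AnyP.lookup-index h'∈)))
  ... | no ne = ⊥-elim (IsReducedGB.reduced R (Any.index h∈) (Any.index h'∈) ne μ ν
                 (subst (λ z → coeff z μ ≢ 0ℚ) (AnyP.lookup-index h∈) nz)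
                 (subst (λ z → IsLM z ν) (AnyP.lookup-index h'∈) lm) ν∣μ)

  module _ {G H : List (Poly n)} (RG : IsReducedGB I G) (RH : IsReducedGB I H) where

    -- If LM g (g ∈ G) divides a monomial δ of h ∈ H, then LM h ∣ LM g:
    -- some LM of H divides LM g, and by reducedness of H it belongs to h.
    LM-divides-LM : ∀ {g h ν μ δ} → g ∈ G → IsLM g ν → ν ∣ᵐ δ →
                    h ∈ H → IsLM h μ → coeff h δ ≢ 0ℚ → μ ∣ᵐ ν
    LM-divides-LM {g} {h} {ν} g∈ lmg ν∣δ h∈ lmh nz
      with IsReducedGB.groebner RH g ν (LA.lookup (IsReducedGB.inIdeal RG) g∈) lmg
    ... | h' , h'∈ , μ' , lmh' , μ'∣ν with reduced-∈ RH h∈ h'∈ nz lmh' (∣ᵐ-trans μ'∣ν ν∣δ)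
    ... | refl = subst (_∣ᵐ ν) (LM-unique h lmh' lmh) μ'∣ν

    divisible⇒leading : ∀ {g h ν μ δ} → g ∈ G → IsLM g ν → ν ∣ᵐ δ →
                        h ∈ H → IsLM h μ → coeff h δ ≢ 0ℚ → δ ≡ μ
    divisible⇒leading {h = h} g∈ lmg ν∣δ h∈ lmh nz =
      LM-divides⇒≡ h lmh nz (∣ᵐ-trans (LM-divides-LM g∈ lmg ν∣δ h∈ lmh nz) ν∣δ)

    partner : ∀ {h μ} → h ∈ H → IsLM h μ → Σ (Poly n) λ g → g ∈ G × IsLM g μ
    partner {h} {μ} h∈ lmh
      with IsReducedGB.groebner RG h μ (LA.lookup (IsReducedGB.inIdeal RH) h∈) lmh
    ... | g , g∈ , ν , lmg , ν∣μ =
      g , g∈ , subst (IsLM g) (∣ᵐ-antisym ν∣μ (LM-divides-LM g∈ lmg ν∣μ h∈ lmh (proj₁ lmh))) lmg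

  -- Monic h ∈ H and g ∈ G with a common leading monomial μ are equal: h − g
  -- lies in I and vanishes at μ, while its leading monomial δ (if any) is
  -- divisible by some LM of G, so δ = μ by `divisible⇒leading`.
  monic-partners-≈ : ∀ {G H} → IsReducedGB I G → IsReducedGB I H → ∀ {g h μ} →
    g ∈ G → IsLM g μ → coeff g μ ≡ 1ℚ → h ∈ H → IsLM h μ → coeff h μ ≡ 1ℚ → h ≈ₚ g
  monic-partners-≈ RG RH {g} {h} {μ} g∈ lmg g1 h∈ lmh h1 ν with coeff h ν Q.≟ coeff g ν
  ... | yes e = e
  ... | no ne = ⊥-elim (no-leading (LM-exists (h -ₚ g) ν (ne ∘ coeff-−≡0 h g ν)))
    where
    d-μ : coeff (h -ₚ g) μ ≡ 0ℚ
    d-μ = trans (coeff-− h g μ) (trans (cong₂ Q._-_ h1 g1) (QP.+-inverseʳ 1ℚ))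
    d∈I : I (h -ₚ g)
    d∈I = closed-− h g (LA.lookup (IsReducedGB.inIdeal RH) h∈) (LA.lookup (IsReducedGB.inIdeal RG) g∈)
    no-leading : Σ (Mon n) (IsLM (h -ₚ g)) → ⊥
    no-leading (δ , lmd) with IsReducedGB.groebner RG (h -ₚ g) δ d∈I lmd
    ... | g' , g'∈ , ν' , lmg' , ν'∣δ = proj₁ lmd (subst (λ x → coeff (h -ₚ g) x ≡ 0ℚ) (sym δ≡μ) d-μ)
      where
      δ≡μ : δ ≡ μ
      δ≡μ with coeff h δ Q.≟ 0ℚ
      ... | no nzh = divisible⇒leading RG RH g'∈ lmg' ν'∣δ h∈ lmh nzh
      ... | yes zh = divisible⇒leading RG RG g'∈ lmg' ν'∣δ g∈ lmg
                       (λ zg → proj₁ lmd (trans (coeff-− h g δ) (cong₂ Q._-_ zh zg)))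

  covered : ∀ {G H} → IsReducedGB I G → IsReducedGB I H →
            All (λ h → Σ (Poly n) λ g → g ∈ G × h ≈ₚ g) H
  covered RG RH = LA.tabulate cover
    where
    cover : ∀ {h} → h ∈ _ → Σ (Poly _) λ g → g ∈ _ × h ≈ₚ g
    cover h∈ with LA.lookup (IsReducedGB.monic RH) h∈
    ... | μ , lmh , h1 with partner RG RH h∈ lmh
    ... | g , g∈ , lmg with LA.lookup (IsReducedGB.monic RG) g∈
    ... | μ' , lmg' , g1 with LM-unique g lmg' lmg
    ... | refl = g , g∈ , monic-partners-≈ RG RH g∈ lmg g1 h∈ lmh h1

index-unmap : ∀ {A B : Set} (f : A → B) (xs : List A) → Fin (length (map f xs)) → Fin (length xs)
index-unmap f (x ∷ xs) zero = zero
index-unmap f (x ∷ xs) (suc i) = suc (index-unmap f xs i)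

lookup-map : ∀ {A B : Set} (f : A → B) (xs : List A) i →
             lookup (map f xs) i ≡ f (lookup xs (index-unmap f xs i))
lookup-map f (x ∷ xs) zero = refl
lookup-map f (x ∷ xs) (suc i) = lookup-map f xs i

index-unmap-injective : ∀ {A B : Set} (f : A → B) (xs : List A) {i j} →
                        index-unmap f xs i ≡ index-unmap f xs j → i ≡ j
index-unmap-injective f (x ∷ xs) {zero} {zero} e = refl
index-unmap-injective f (x ∷ xs) {suc i} {suc j} e =
  cong suc (index-unmap-injective f xs (FP.suc-injective e))

module PowerSubstitution (k : ℕ) where
  m : ℕ
  m = N.suc k

  _ᵐ : ∀ {n} → Poly n → Poly n
  p ᵐ = powSubst m p

  scale : ∀ {n} → Mon n → Mon n
  scale = V.map (N._* m)

  scale-injective : ∀ {n} {x y : Mon n} → scale x ≡ scale y → x ≡ y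
  scale-injective {x = []} {[]} e = refl
  scale-injective {x = a ∷ x} {b ∷ y} e =
    cong₂ _∷_ (NP.*-cancelʳ-≡ a b m (cong V.head e)) (scale-injective (cong V.tail e))

  scale-+ : ∀ {n} (ν σ : Mon n) → scale (zipWith N._+_ ν σ) ≡ zipWith N._+_ (scale ν) (scale σ)
  scale-+ [] [] = refl
  scale-+ (a ∷ ν) (b ∷ σ) = cong₂ _∷_ (NP.*-distribʳ-+ m a b) (scale-+ ν σ)

  scale-mono : ∀ {n} {x y : Mon n} → x >lex y → scale x >lex scale y
  scale-mono (here b<a) = here (NP.*-monoˡ-< m b<a)
  scale-mono (there p) = there (scale-mono p)

  scale-∣ᵐ⁻¹ : ∀ {n} {x y : Mon n} → scale x ∣ᵐ scale y → x ∣ᵐ y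
  scale-∣ᵐ⁻¹ {x = []} {[]} PW.[] = PW.[]
  scale-∣ᵐ⁻¹ {x = a ∷ x} {b ∷ y} (p PW.∷ ps) = NP.*-cancelʳ-≤ a b m p PW.∷ scale-∣ᵐ⁻¹ ps

  module Subst {n : ℕ} = TermMap {n} (λ a → a) scale refl (λ _ _ → refl) scale-injective

  coeff-ᵐ : ∀ {n} (p : Poly n) x → coeff (p ᵐ) (scale x) ≡ coeff p x
  coeff-ᵐ = Subst.coeff-image

  support-ᵐ : ∀ {n} (p : Poly n) μ → coeff (p ᵐ) μ ≢ 0ℚ → Σ (Mon _) λ x → μ ≡ scale x
  support-ᵐ = Subst.support-image

  termMul-ᵐ : ∀ {n} c (ν : Mon n) (s : Poly n) → (termMul c ν s) ᵐ ≡ termMul c (scale ν) (s ᵐ)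
  termMul-ᵐ c ν [] = refl
  termMul-ᵐ c ν ((d , σ) ∷ s) = cong₂ _∷_ (cong (_ ,_) (scale-+ ν σ)) (termMul-ᵐ c ν s)

  *ₚ-ᵐ : ∀ {n} (p q : Poly n) → (p *ₚ q) ᵐ ≡ (p ᵐ) *ₚ (q ᵐ)
  *ₚ-ᵐ [] q = refl
  *ₚ-ᵐ ((c , ν) ∷ p) q =
    trans (LP.map-++ _ (termMul c ν q) (p *ₚ q)) (cong₂ _++_ (termMul-ᵐ c ν q) (*ₚ-ᵐ p q))

  pairᵐ : ∀ {n} → Poly n × Poly n → Poly n × Poly n
  pairᵐ hs = (proj₁ hs ᵐ , proj₂ hs ᵐ)

  sum-ᵐ : ∀ {n} (cs : List (Poly n × Poly n)) → (sumₚ (map term cs)) ᵐ ≡ sumₚ (map term (map pairᵐ cs))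
  sum-ᵐ [] = refl
  sum-ᵐ ((h , s) ∷ cs) =
    trans (LP.map-++ _ (h *ₚ s) (sumₚ (map term cs))) (cong₂ _++_ (*ₚ-ᵐ h s) (sum-ᵐ cs))

  ⟨⟩-ᵐ : ∀ {n} (S : PolySet n) g → ⟨ S ⟩ g → ⟨ S ^ˢ m ⟩ (g ᵐ)
  ⟨⟩-ᵐ S g (cs , Scs , g≈) =
    map pairᵐ cs , LAP.map⁺ (LA.map (λ {hs} s∈S → proj₂ hs , s∈S , (λ _ → refl)) Scs) ,
    λ μ → trans (Subst.resp-≈ g (sumₚ (map term cs)) g≈ μ) (cong (λ z → coeff z μ) (sum-ᵐ cs))

  IsLM-ᵐ : ∀ {n} (g : Poly n) ν → IsLM g ν → IsLM (g ᵐ) (scale ν)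
  IsLM-ᵐ g ν (nz , max) = (λ z → nz (trans (sym (coeff-ᵐ g ν)) z)) , max'
    where
    max' : ∀ μ → coeff (g ᵐ) μ ≢ 0ℚ → μ ≢ scale ν → scale ν >lex μ
    max' μ nzμ ne with support-ᵐ g μ nzμ
    ... | x , refl = scale-mono (max x (λ z → nzμ (trans (coeff-ᵐ g x) z)) (ne ∘ cong scale))

  euclid-unique : ∀ {a r q} → r N.< m → a ≡ r N.+ q N.* m → a % m ≡ r × a / m ≡ q
  euclid-unique {a} {r} {q} r<m refl = rem , quot
    where
    rem : (r N.+ q N.* m) % m ≡ r
    rem = trans ([m+kn]%n≡m%n r q m) (m<n⇒m%n≡m r<m)
    quot : (r N.+ q N.* m) / m ≡ q
    quot = NP.*-cancelʳ-≡ _ q m (NP.+-cancelˡ-≡ r _ _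
             (trans (cong (N._+ ((r N.+ q N.* m) / m) N.* m) (sym rem))
                    (sym (m≡m%n+[m/n]*n (r N.+ q N.* m) m))))

  Residue : ∀ {n} → Mon n → Set
  Residue = VA.All (N._< m)

  rem quot : ∀ {n} → Mon n → Mon n
  rem = V.map (_% m)
  quot = V.map (_/ m)

  shiftScale : ∀ {n} → Mon n → Mon n → Mon n
  shiftScale r x = zipWith N._+_ r (scale x)

  rem-residue : ∀ {n} (σ : Mon n) → Residue (rem σ)
  rem-residue [] = VA.[]
  rem-residue (a ∷ σ) = m%n<n a m VA.∷ rem-residue σ

  euclid : ∀ {n} (σ : Mon n) → σ ≡ shiftScale (rem σ) (quot σ)
  euclid [] = refl
  euclid (a ∷ σ) = cong₂ _∷_ (m≡m%n+[m/n]*n a m) (euclid σ)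

  euclid⁻¹ : ∀ {n} {r x σ : Mon n} → Residue r → σ ≡ shiftScale r x → rem σ ≡ r × quot σ ≡ x
  euclid⁻¹ {r = []} {[]} {[]} VA.[] e = refl , refl
  euclid⁻¹ {r = c ∷ r} {a ∷ x} {b ∷ σ} (c<m VA.∷ res) e
    with euclid-unique {b} {c} {a} c<m (cong V.head e) | euclid⁻¹ res (cong V.tail e)
  ... | e₁ , e₂ | f₁ , f₂ = cong₂ _∷_ e₁ f₁ , cong₂ _∷_ e₂ f₂

  shiftScale-injective : ∀ {n} {r x y : Mon n} → Residue r → shiftScale r x ≡ shiftScale r y → x ≡ y
  shiftScale-injective res e = trans (sym (proj₂ (euclid⁻¹ res refl))) (proj₂ (euclid⁻¹ res e))

  rem-shift : ∀ {n} (σ u : Mon n) → rem (zipWith N._+_ σ (scale u)) ≡ rem σ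
  rem-shift [] [] = refl
  rem-shift (a ∷ σ) (b ∷ u) = cong₂ _∷_ ([m+kn]%n≡m%n a b m) (rem-shift σ u)

  quot-shift : ∀ {n} (σ u : Mon n) → quot (zipWith N._+_ σ (scale u)) ≡ zipWith N._+_ (quot σ) u
  quot-shift [] [] = refl
  quot-shift (a ∷ σ) (b ∷ u) = cong₂ _∷_ quot-a (quot-shift σ u)
    where
    quot-a : (a N.+ b N.* m) / m ≡ a / m N.+ b
    quot-a = proj₂ (euclid-unique {a N.+ b N.* m} {a % m} {a / m N.+ b} (m%n<n a m)
               (trans (cong (N._+ b N.* m) (m≡m%n+[m/n]*n a m))
               (trans (NP.+-assoc (a % m) _ _)
                      (cong (a % m N.+_) (sym (NP.*-distribʳ-+ m (a / m) b))))))

  scale-∣ᵐ-shift : ∀ {n} (r q x : Mon n) → x ∣ᵐ q → scale x ∣ᵐ shiftScale r q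
  scale-∣ᵐ-shift [] [] [] PW.[] = PW.[]
  scale-∣ᵐ-shift (c ∷ r) (a ∷ q) (b ∷ x) (b≤a PW.∷ x∣q) =
    NP.≤-trans (NP.*-monoˡ-≤ m b≤a) (NP.m≤n+m _ c) PW.∷ scale-∣ᵐ-shift r q x x∣q

  shiftScale-reflects : ∀ {n} {X Y : Mon n} (r a b : Mon n) → X >lex Y →
                        X ≡ shiftScale r a → Y ≡ shiftScale r b → a >lex b
  shiftScale-reflects (c ∷ r) (x ∷ a) (y ∷ b) (here B<A) eX eY =
    here (NP.*-cancelʳ-< m y x (NP.+-cancelˡ-< c _ _
      (subst₂ N._<_ (cong V.head eY) (cong V.head eX) B<A)))
  shiftScale-reflects (c ∷ r) (x ∷ a) (y ∷ b) (there p) eX eY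
    with NP.*-cancelʳ-≡ x y m (NP.+-cancelˡ-≡ c _ _ (trans (sym (cong V.head eX)) (cong V.head eY)))
  ... | refl = there (shiftScale-reflects r a b p (cong V.tail eX) (cong V.tail eY))

  slice : ∀ {n} → Mon n → Poly n → Poly n
  slice r [] = []
  slice r ((c , σ) ∷ p) with ≡-dec N._≟_ (rem σ) r
  ... | yes _ = (c , quot σ) ∷ slice r p
  ... | no _ = slice r p

  coeff-slice : ∀ {n} {r : Mon n} → Residue r → ∀ p x → coeff (slice r p) x ≡ coeff p (shiftScale r x)
  coeff-slice res [] x = refl
  coeff-slice {r = r} res ((c , σ) ∷ p) x with ≡-dec N._≟_ (rem σ) r | ≡-dec N._≟_ σ (shiftScale r x)
  ... | yes e₁ | yes e₂ with ≡-dec N._≟_ (quot σ) x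
  ...   | yes _ = cong (c Q.+_) (coeff-slice res p x)
  ...   | no ne = ⊥-elim (ne (proj₂ (euclid⁻¹ res e₂)))
  coeff-slice {r = r} res ((c , σ) ∷ p) x | yes e₁ | no ne₂ with ≡-dec N._≟_ (quot σ) x
  ...   | yes e = ⊥-elim (ne₂ (trans (euclid σ) (cong₂ shiftScale e₁ e)))
  ...   | no _ = coeff-slice res p x
  coeff-slice res ((c , σ) ∷ p) x | no ne₁ | yes e₂ = ⊥-elim (ne₁ (proj₁ (euclid⁻¹ res e₂)))
  coeff-slice res ((c , σ) ∷ p) x | no ne₁ | no _ = coeff-slice res p x

  slice-++ : ∀ {n} (r : Mon n) p q → slice r (p ++ q) ≡ slice r p ++ slice r q
  slice-++ r [] q = refl
  slice-++ r ((c , σ) ∷ p) q with ≡-dec N._≟_ (rem σ) r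
  ... | yes _ = cong (_ ∷_) (slice-++ r p q)
  ... | no _ = slice-++ r p q

  slice-termMul-yes : ∀ {n} (r : Mon n) c σ → rem σ ≡ r → ∀ P →
                      slice r (termMul c σ (P ᵐ)) ≡ termMul c (quot σ) P
  slice-termMul-yes r c σ e [] = refl
  slice-termMul-yes r c σ e ((d , u) ∷ P) with ≡-dec N._≟_ (rem (zipWith N._+_ σ (scale u))) r
  ... | yes _ = cong₂ _∷_ (cong (_ ,_) (quot-shift σ u)) (slice-termMul-yes r c σ e P)
  ... | no ne = ⊥-elim (ne (trans (rem-shift σ u) e))

  slice-termMul-no : ∀ {n} (r : Mon n) c σ → rem σ ≢ r → ∀ P → slice r (termMul c σ (P ᵐ)) ≡ []
  slice-termMul-no r c σ ne [] = refl
  slice-termMul-no r c σ ne ((d , u) ∷ P) with ≡-dec N._≟_ (rem (zipWith N._+_ σ (scale u))) r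
  ... | yes e = ⊥-elim (ne (trans (sym (rem-shift σ u)) e))
  ... | no _ = slice-termMul-no r c σ ne P

  slice-*ₚ-ᵐ : ∀ {n} (r : Mon n) h P → slice r (h *ₚ (P ᵐ)) ≡ slice r h *ₚ P
  slice-*ₚ-ᵐ r [] P = refl
  slice-*ₚ-ᵐ r ((c , σ) ∷ h) P with ≡-dec N._≟_ (rem σ) r
  ... | yes e = trans (slice-++ r (termMul c σ (P ᵐ)) (h *ₚ (P ᵐ)))
                      (cong₂ _++_ (slice-termMul-yes r c σ e P) (slice-*ₚ-ᵐ r h P))
  ... | no ne = trans (slice-++ r (termMul c σ (P ᵐ)) (h *ₚ (P ᵐ)))
                      (trans (cong (_++ slice r (h *ₚ (P ᵐ))) (slice-termMul-no r c σ ne P))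
                             (slice-*ₚ-ᵐ r h P))

  slice-combination : ∀ {n} (S : PolySet n) {r : Mon n} → Residue r →
    ∀ cs → All (λ hs → (S ^ˢ m) (proj₂ hs)) cs →
    Σ (List (Poly n × Poly n)) λ ds → All (λ hs → S (proj₂ hs)) ds ×
      (slice r (sumₚ (map term cs)) ≈ₚ sumₚ (map term ds))
  slice-combination S res [] [] = [] , [] , λ _ → refl
  slice-combination S {r} res ((h , Q) ∷ cs) ((P , P∈S , Q≈) ∷ Scs)
    with slice-combination S res cs Scs
  ... | ds , Sds , rest≈ = (slice r h , P) ∷ ds , P∈S ∷ Sds , λ x →
    trans (cong (λ z → coeff z x) (slice-++ r (h *ₚ Q) (sumₚ (map term cs))))
    (trans (coeff-++ (slice r (h *ₚ Q)) _ x)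
    (trans (cong₂ Q._+_ (head≈ x) (rest≈ x))
           (sym (coeff-++ (slice r h *ₚ P) _ x))))
    where
    head≈ : ∀ x → coeff (slice r (h *ₚ Q)) x ≡ coeff (slice r h *ₚ P) x
    head≈ x = begin
      coeff (slice r (h *ₚ Q)) x             ≡⟨ coeff-slice res (h *ₚ Q) x ⟩
      coeff (h *ₚ Q) (shiftScale r x)        ≡⟨ *ₚ-respʳ-≈ h Q (P ᵐ) Q≈ (shiftScale r x) ⟩
      coeff (h *ₚ (P ᵐ)) (shiftScale r x)    ≡⟨ sym (coeff-slice res (h *ₚ (P ᵐ)) x) ⟩
      coeff (slice r (h *ₚ (P ᵐ))) x         ≡⟨ cong (λ z → coeff z x) (slice-*ₚ-ᵐ r h P) ⟩
      coeff (slice r h *ₚ P) x               ∎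
      where open ≡-Reasoning

  slice-⟨⟩ : ∀ {n} (S : PolySet n) {r : Mon n} → Residue r → ∀ f → ⟨ S ^ˢ m ⟩ f → ⟨ S ⟩ (slice r f)
  slice-⟨⟩ S {r} res f (cs , Scs , f≈) with slice-combination S res cs Scs
  ... | ds , Sds , slice≈ = ds , Sds , λ x →
    trans (coeff-slice res f x) (trans (f≈ (shiftScale r x))
      (trans (sym (coeff-slice res (sumₚ (map term cs)) x)) (slice≈ x)))

  IsLM-slice : ∀ {n} (f : Poly n) μ → IsLM f μ → IsLM (slice (rem μ) f) (quot μ)
  IsLM-slice f μ (nz , max) =
    (λ z → nz (trans (cong (coeff f) (euclid μ)) (trans (sym (coeff-slice res f (quot μ))) z))) ,
    λ ν nzν ne → shiftScale-reflects (rem μ) (quot μ) ν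
      (max (shiftScale (rem μ) ν) (λ z → nzν (trans (coeff-slice res f ν) z))
           (λ e → ne (shiftScale-injective res (trans e (euclid μ)))))
      (euclid μ) refl
    where
    res = rem-residue μ

  -- Gröbner property of Gᵐ: slice f ∈ ⟨Sᵐ⟩ at the residue of its leading
  -- monomial μ = r + m·q, divide q by some LM g, and scale back.
  groebner-ᵐ : ∀ {n} (S : PolySet n) (G : List (Poly n)) → IsReducedGB ⟨ S ⟩ G →
    ∀ f μ → ⟨ S ^ˢ m ⟩ f → IsLM f μ →
    Σ (Poly n) λ g → g ∈ map _ᵐ G × Σ (Mon n) λ ν → IsLM g ν × ν ∣ᵐ μ
  groebner-ᵐ S G RG f μ f∈ lmf
    with IsReducedGB.groebner RG (slice (rem μ) f) (quot μ)
           (slice-⟨⟩ S (rem-residue μ) f f∈) (IsLM-slice f μ lmf)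
  ... | g , g∈ , ν , lmg , ν∣q = g ᵐ , ∈-map⁺ _ᵐ g∈ , scale ν , IsLM-ᵐ g ν lmg ,
    subst (scale ν ∣ᵐ_) (sym (euclid μ)) (scale-∣ᵐ-shift (rem μ) (quot μ) ν ν∣q)

  -- Reducedness of G, read off at the substituted elements gᵢᵐ and gⱼᵐ:
  -- monomials of gᵢᵐ and the leading monomial of gⱼᵐ are m-multiples.
  reduced-at-ᵐ : ∀ {n} {S : PolySet n} {G : List (Poly n)} → IsReducedGB ⟨ S ⟩ G →
    ∀ (i j : Fin (length G)) → i ≢ j → ∀ μ ν →
    coeff (lookup G i ᵐ) μ ≢ 0ℚ → IsLM (lookup G j ᵐ) ν → ¬ (ν ∣ᵐ μ)
  reduced-at-ᵐ {G = G} RG i j i≢j μ ν nzμ lmν ν∣μ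
    with support-ᵐ (lookup G i) μ nzμ | LA.lookup (IsReducedGB.monic RG) (∈-lookup j)
  ... | x , refl | νⱼ , lmⱼ , _ with LM-unique (lookup G j ᵐ) lmν (IsLM-ᵐ (lookup G j) νⱼ lmⱼ)
  ... | refl = IsReducedGB.reduced RG i j i≢j x νⱼ
                 (λ z → nzμ (trans (coeff-ᵐ (lookup G i) x) z)) lmⱼ (scale-∣ᵐ⁻¹ ν∣μ)

  reduced-ᵐ : ∀ {n} (S : PolySet n) (G : List (Poly n)) → IsReducedGB ⟨ S ⟩ G →
    ∀ (i j : Fin (length (map _ᵐ G))) → i ≢ j → ∀ μ ν →
    coeff (lookup (map _ᵐ G) i) μ ≢ 0ℚ → IsLM (lookup (map _ᵐ G) j) ν → ¬ (ν ∣ᵐ μ)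
  reduced-ᵐ S G RG i j i≢j μ ν nzμ lmν =
    reduced-at-ᵐ RG (index-unmap _ᵐ G i) (index-unmap _ᵐ G j) (i≢j ∘ index-unmap-injective _ᵐ G) μ ν
      (subst (λ z → coeff z μ ≢ 0ℚ) (lookup-map _ᵐ G i) nzμ)
      (subst (λ z → IsLM z ν) (lookup-map _ᵐ G j) lmν)

  reducedGB-ᵐ : ∀ {n} (S : PolySet n) (G : List (Poly n)) → IsReducedGB ⟨ S ⟩ G →
                IsReducedGB ⟨ S ^ˢ m ⟩ (map _ᵐ G)
  reducedGB-ᵐ S G RG = record
    { inIdeal = LAP.map⁺ (LA.map (λ {g} → ⟨⟩-ᵐ S g) (IsReducedGB.inIdeal RG))
    ; monic = LAP.map⁺ (LA.map (λ {g} → λ { (ν , lm , g1) → scale ν , IsLM-ᵐ g ν lm , trans (coeff-ᵐ g ν) g1 })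
                (IsReducedGB.monic RG))
    ; groebner = groebner-ᵐ S G RG
    ; reduced = reduced-ᵐ S G RG
    }

proposition3p1 : (n : ℕ) (S : PolySet n) (m : ℕ) → 1 ≤ m →
    (G H : List (Poly n)) → IsReducedGB ⟨ S ⟩ G → IsReducedGB ⟨ S ^ˢ m ⟩ H →
    H ≈ˢ map (powSubst m) G
proposition3p1 n S (N.suc k) (s≤s z≤n) G H RG RH =
  covered Gᵐ-reduced RH , covered RH Gᵐ-reduced
  where
  Gᵐ-reduced = PowerSubstitution.reducedGB-ᵐ k S G RG
  open Uniqueness ⟨ S ^ˢ N.suc k ⟩ (⟨⟩-closed-− (S ^ˢ N.suc k))
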